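{- For every $d\le 11$, the cube $Q^d$ is stackable.
   Context: $Q^d$ has vertex set $\{0,1\}^d$, adjacency meaning differing in exactly one coordinate. A configuration is a function $C:V\to\mathbb{N}$ (numbers of cups); a cup stacking move from $u$ to $v$ is allowed when $C(u)\ge1$, $C(v)\ge1$ and $\mathrm{dist}(u,v)=C(u)$, and moves all cups of $u$ onto $v$. A graph is stackable if for every vertex $r$, starting with one cup on every vertex, some sequence of moves puts all cups on $r$. -}

module Defs where

open import Data.Nat using (ℕ; zero; suc; _+_; _≥_)
open import Data.Bool using (Bool; true; false; if_then_else_)
open import Data.Vec using (Vec; []; _∷_)
open import Relation.Binary.PropositionalEquality using (_≡_; _≢_)
open import Relation.Nullary using (Dec; does)
open import Data.Product using (∃; _×_)
open import Relation.Binary.Construct.Closure.ReflexiveTransitive using (Star)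
open import Data.Vec.Properties using (≡-dec)
open import Data.Bool.Properties using () renaming (_≟_ to _≟B_)

Vertex : ℕ → Set
Vertex d = Vec Bool d

_≟V_ : ∀ {d} (u v : Vertex d) → Dec (u ≡ v)
_≟V_ = ≡-dec _≟B_

-- Graph distance in Q^d = Hamming distance.
dist : ∀ {d} → Vertex d → Vertex d → ℕ
dist [] [] = zero
dist (x ∷ u) (y ∷ v) = if does (x ≟B y) then dist u v else suc (dist u v)

Config : ℕ → Set
Config d = Vertex d → ℕ

data Move {d : ℕ} (C : Config d) : Config d → Set where
  move : (u v : Vertex d) → C u ≥ 1 → C v ≥ 1 → dist u v ≡ C u →
         Move C (λ w → if does (w ≟V u) then 0
                       else if does (w ≟V v) then C v + C u
                       else C w)

Reachable : ∀ {d} → Config d → Config d → Set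
Reachable = Star Move

initial : ∀ {d} → Config d
initial _ = 1

Stackable : ℕ → Set
Stackable d = (r : Vertex d) →
  ∃ λ (C : Config d) → Reachable initial C × ((w : Vertex d) → w ≢ r → C w ≡ 0)

-- Translations x ↦ r ⊕ x are distance-preserving automorphisms of Q^d acting
-- transitively on vertices, and a move sequence can be carried along any such
-- automorphism; so it is enough to stack every cup onto the origin. That is
-- done by one explicit sequence of 2047 moves on Q^11 whose first 2^d − 1 moves
-- stay inside the subcube Q^d and already stack it onto the origin. Each of
-- these sequences is certified by replaying it on a table of cup counts.
module Submission where

open import Defs
open import Data.Nat using (ℕ; zero; suc; _+_; _∸_; _≤_; _^_; _≤?_; _/_; _%_; _≡ᵇ_; s≤s)
open import Data.Nat.Properties using (_≟_)
open import Data.Bool using (true; false; if_then_else_; _xor_)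
open import Data.Bool.Properties using (not-involutive) renaming (_≟_ to _≟B_)
open import Data.Vec using ([]; _∷_; replicate; zipWith)
open import Data.List using (List; []; _∷_; map; take)
open import Data.Product using (∃; _×_; _,_)
open import Data.Maybe using (Maybe; just; nothing)
open import Data.Empty using (⊥-elim)
open import Function using (_∘_)
open import Function.Bundles using (mk⇔)
open import Relation.Binary.PropositionalEquality
open import Relation.Nullary using (yes; no; does)
open import Relation.Nullary.Decidable using (does-⇔)
open import Relation.Binary.Construct.Closure.ReflexiveTransitive using (Star; ε; _◅_)

-- Since the target of a move is a fixed λ-term, reachability is first tracked
-- up to pointwise equality of configurations.
Move≗ : ∀ {d} → Config d → Config d → Set
Move≗ C D = ∃ λ C′ → Move C C′ × C′ ≗ D

Reachable≗ : ∀ {d} → Config d → Config d → Set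
Reachable≗ = Star Move≗

move-resp-≗ : ∀ {d} {C E X : Config d} → C ≗ E → Move C X → ∃ λ Y → Move E Y × Y ≗ X
move-resp-≗ {C = C} {E} C≗E (move u v Cu≥1 Cv≥1 dist≡Cu) =
  _ , move u v (subst (1 ≤_) (C≗E u) Cu≥1) (subst (1 ≤_) (C≗E v) Cv≥1) (trans dist≡Cu (C≗E u)) , agree
  where
  agree : ∀ w → (if does (w ≟V u) then 0 else if does (w ≟V v) then E v + E u else E w)
              ≡ (if does (w ≟V u) then 0 else if does (w ≟V v) then C v + C u else C w)
  agree w with w ≟V u | w ≟V v
  ... | yes _ | _     = refl
  ... | no _  | yes _ = sym (cong₂ _+_ (C≗E v) (C≗E u))
  ... | no _  | no _  = sym (C≗E w)

reachable≗⇒reachable : ∀ {d} {C D E : Config d} → Reachable≗ C D → C ≗ E →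
                       ∃ λ F → Reachable E F × F ≗ D
reachable≗⇒reachable {E = E} ε C≗E = E , ε , sym ∘ C≗E
reachable≗⇒reachable ((X , C→X , X≗Y) ◅ Y⇝D) C≗E with move-resp-≗ C≗E C→X
... | X′ , E→X′ , X′≗X with reachable≗⇒reachable Y⇝D (λ w → trans (sym (X≗Y w)) (sym (X′≗X w)))
...   | F , X′⇝F , F≗D = F , E→X′ ◅ X′⇝F , F≗D

Isometry : ∀ {d} → (Vertex d → Vertex d) → Set
Isometry σ = ∀ u v → dist (σ u) (σ v) ≡ dist u v

module _ {d : ℕ} (σ ρ : Vertex d → Vertex d) (σρ≗id : ∀ u → σ (ρ u) ≡ u)
         (ρσ≗id : ∀ u → ρ (σ u) ≡ u) (σ-isometry : Isometry σ) where

  move-∘ : ∀ {C X : Config d} → Move C X → Move≗ (C ∘ σ) (X ∘ σ)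
  move-∘ {C} (move u v Cu≥1 Cv≥1 dist≡Cu) =
    _ , move (ρ u) (ρ v) (at-ρ u Cu≥1) (at-ρ v Cv≥1) dist-ρ , agree
    where
    at-ρ : ∀ x → 1 ≤ C x → 1 ≤ C (σ (ρ x))
    at-ρ x = subst (λ y → 1 ≤ C y) (sym (σρ≗id x))

    dist-ρ : dist (ρ u) (ρ v) ≡ C (σ (ρ u))
    dist-ρ = begin
      dist (ρ u) (ρ v)         ≡⟨ sym (σ-isometry (ρ u) (ρ v)) ⟩
      dist (σ (ρ u)) (σ (ρ v)) ≡⟨ cong₂ dist (σρ≗id u) (σρ≗id v) ⟩
      dist u v                 ≡⟨ dist≡Cu ⟩
      C u                      ≡⟨ cong C (sym (σρ≗id u)) ⟩
      C (σ (ρ u))              ∎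
      where open ≡-Reasoning

    ≡ρ⇔σ≡ : ∀ w x → does (w ≟V ρ x) ≡ does (σ w ≟V x)
    ≡ρ⇔σ≡ w x = does-⇔ (mk⇔ (λ w≡ρx → trans (cong σ w≡ρx) (σρ≗id x))
                            (λ σw≡x → trans (sym (ρσ≗id w)) (cong ρ σw≡x)))
                       (w ≟V ρ x) (σ w ≟V x)

    agree : ∀ w → (if does (w ≟V ρ u) then 0 else if does (w ≟V ρ v)
                    then C (σ (ρ v)) + C (σ (ρ u)) else C (σ w))
                ≡ (if does (σ w ≟V u) then 0 else if does (σ w ≟V v) then C v + C u else C (σ w))
    agree w rewrite ≡ρ⇔σ≡ w u | ≡ρ⇔σ≡ w v | σρ≗id u | σρ≗id v = refl

  reachable≗-∘ : ∀ {C D : Config d} → Reachable≗ C D → Reachable≗ (C ∘ σ) (D ∘ σ)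
  reachable≗-∘ ε = ε
  reachable≗-∘ ((X , C→X , X≗Y) ◅ Y⇝D) with move-∘ C→X
  ... | X′ , Cσ→X′ , X′≗Xσ = (X′ , Cσ→X′ , λ w → trans (X′≗Xσ w) (X≗Y (σ w))) ◅ reachable≗-∘ Y⇝D

origin : ∀ {d} → Vertex d
origin = replicate _ false

_⊕_ : ∀ {d} → Vertex d → Vertex d → Vertex d
_⊕_ = zipWith _xor_

xor-involutive : ∀ b x → b xor (b xor x) ≡ x
xor-involutive false x = refl
xor-involutive true  x = not-involutive x

⊕-involutive : ∀ {d} (r w : Vertex d) → r ⊕ (r ⊕ w) ≡ w
⊕-involutive []      []      = refl
⊕-involutive (b ∷ r) (x ∷ w) = cong₂ _∷_ (xor-involutive b x) (⊕-involutive r w)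

⊕-identityʳ : ∀ {d} (r : Vertex d) → r ⊕ origin ≡ r
⊕-identityʳ []          = refl
⊕-identityʳ (false ∷ r) = cong (false ∷_) (⊕-identityʳ r)
⊕-identityʳ (true ∷ r)  = cong (true ∷_) (⊕-identityʳ r)

⊕-isometry : ∀ {d} (r : Vertex d) → Isometry (r ⊕_)
⊕-isometry []      []      []      = refl
⊕-isometry (b ∷ r) (x ∷ u) (y ∷ v) =
  cong₂ (λ same n → if same then n else suc n) same-bit (⊕-isometry r u v)
  where
  same-bit : does (b xor x ≟B b xor y) ≡ does (x ≟B y)
  same-bit = does-⇔ (mk⇔ (λ e → trans (sym (xor-involutive b x)) (trans (cong (b xor_) e) (xor-involutive b y)))
                         (cong (b xor_)))
                    (b xor x ≟B b xor y) (x ≟B y)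

stackable-from-origin : ∀ {d} {C₀ C : Config d} → C₀ ≗ initial → Reachable≗ C₀ C →
                        (∀ w → w ≢ origin → C w ≡ 0) → Stackable d
stackable-from-origin C₀≗initial C₀⇝C elsewhere-empty r
  with reachable≗⇒reachable (reachable≗-∘ (r ⊕_) (r ⊕_) (⊕-involutive r) (⊕-involutive r) (⊕-isometry r) C₀⇝C)
                            (C₀≗initial ∘ (r ⊕_))
... | F , initial→F , F≗C = F , initial→F , λ w w≢r →
  trans (F≗C w) (elsewhere-empty (r ⊕ w) λ r⊕w≡o → w≢r (begin
    w              ≡⟨ sym (⊕-involutive r w) ⟩
    r ⊕ (r ⊕ w)    ≡⟨ cong (r ⊕_) r⊕w≡o ⟩
    r ⊕ origin     ≡⟨ ⊕-identityʳ r ⟩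
    r              ∎))
  where open ≡-Reasoning

data Table : ℕ → Set where
  leaf : ℕ → Table zero
  node : ∀ {d} → Table d → Table d → Table (suc d)

lookup : ∀ {d} → Table d → Vertex d → ℕ
lookup (leaf n)   []          = n
lookup (node f t) (false ∷ w) = lookup f w
lookup (node f t) (true ∷ w)  = lookup t w

update : ∀ {d} → Table d → Vertex d → ℕ → Table d
update (leaf _)   []          n = leaf n
update (node f t) (false ∷ w) n = node (update f w n) t
update (node f t) (true ∷ w)  n = node f (update t w n)

lookup-update-≡ : ∀ {d} (T : Table d) u n → lookup (update T u n) u ≡ n
lookup-update-≡ (leaf _)   []          n = refl
lookup-update-≡ (node f t) (false ∷ u) n = lookup-update-≡ f u n
lookup-update-≡ (node f t) (true ∷ u)  n = lookup-update-≡ t u n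

lookup-update-≢ : ∀ {d} (T : Table d) u n w → w ≢ u → lookup (update T u n) w ≡ lookup T w
lookup-update-≢ (leaf _)   []          n []          w≢u = ⊥-elim (w≢u refl)
lookup-update-≢ (node f t) (false ∷ u) n (false ∷ w) w≢u = lookup-update-≢ f u n w (w≢u ∘ cong (false ∷_))
lookup-update-≢ (node f t) (false ∷ u) n (true ∷ w)  w≢u = refl
lookup-update-≢ (node f t) (true ∷ u)  n (false ∷ w) w≢u = refl
lookup-update-≢ (node f t) (true ∷ u)  n (true ∷ w)  w≢u = lookup-update-≢ t u n w (w≢u ∘ cong (true ∷_))

stack : ∀ {d} → Table d → Vertex d → Vertex d → Table d
stack T u v = update (update T v (lookup T v + lookup T u)) u 0

lookup-stack : ∀ {d} (T : Table d) u v w → lookup (stack T u v) w ≡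
  (if does (w ≟V u) then 0 else if does (w ≟V v) then lookup T v + lookup T u else lookup T w)
lookup-stack T u v w with w ≟V u | w ≟V v
... | yes refl | _        = lookup-update-≡ (update T v _) w 0
... | no w≢u   | yes refl = trans (lookup-update-≢ (update T w _) u 0 w w≢u) (lookup-update-≡ T w _)
... | no w≢u   | no w≢v   = trans (lookup-update-≢ (update T v _) u 0 w w≢u) (lookup-update-≢ T v _ w w≢v)

replay : ∀ {d} → Table d → List (Vertex d × Vertex d) → Maybe (Table d)
replay T []             = just T
replay T ((u , v) ∷ ms) with 1 ≤? lookup T u | 1 ≤? lookup T v | dist u v ≟ lookup T u
... | yes _ | yes _ | yes _ = replay (stack T u v) ms
... | _     | _     | _     = nothing

replay-sound : ∀ {d} (T : Table d) ms {T′} → replay T ms ≡ just T′ → Reachable≗ (lookup T) (lookup T′)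
replay-sound T [] refl = ε
replay-sound T ((u , v) ∷ ms) replayed
  with 1 ≤? lookup T u | 1 ≤? lookup T v | dist u v ≟ lookup T u
... | yes Tu≥1 | yes Tv≥1 | yes dist≡Tu =
  (_ , move u v Tu≥1 Tv≥1 dist≡Tu , sym ∘ lookup-stack T u v) ◅ replay-sound (stack T u v) ms replayed
... | no _     | _        | _     with () ← replayed
... | yes _    | no _     | _     with () ← replayed
... | yes _    | yes _    | no _  with () ← replayed

constant : ∀ d → ℕ → Table d
constant zero    n = leaf n
constant (suc d) n = node (constant d n) (constant d n)

lookup-constant : ∀ {d} n (w : Vertex d) → lookup (constant d n) w ≡ n
lookup-constant n []          = refl
lookup-constant n (false ∷ w) = lookup-constant n w
lookup-constant n (true ∷ w)  = lookup-constant n w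

pile : ∀ d → ℕ → Table d
pile zero    n = leaf n
pile (suc d) n = node (pile d n) (constant d 0)

lookup-pile-≢ : ∀ {d} n (w : Vertex d) → w ≢ origin → lookup (pile d n) w ≡ 0
lookup-pile-≢ n []          w≢o = ⊥-elim (w≢o refl)
lookup-pile-≢ n (false ∷ w) w≢o = lookup-pile-≢ n w (w≢o ∘ cong (false ∷_))
lookup-pile-≢ n (true ∷ w)  w≢o = lookup-constant 0 w

stackable-by-replay : ∀ d (ms : List (Vertex d × Vertex d)) →
                      replay (constant d 1) ms ≡ just (pile d (2 ^ d)) → Stackable d
stackable-by-replay d ms replayed =
  stackable-from-origin (lookup-constant 1) (replay-sound (constant d 1) ms replayed) (lookup-pile-≢ (2 ^ d))

-- Vertex n of Q^d has coordinates the d lowest binary digits of n, least significant first.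
toVertex : ∀ d → ℕ → Vertex d
toVertex zero    _ = []
toVertex (suc d) n = (n % 2 ≡ᵇ 1) ∷ toVertex d (n / 2)

moves₁₁ : List (ℕ × ℕ)
moves₁₁ =
  (1 , 0) ∷ (2 , 3) ∷ (3 , 0) ∷ (4 , 0) ∷ (5 , 7) ∷ (6 , 7) ∷ (7 , 0) ∷ (8 , 0) ∷ (9 , 11) ∷ (10 , 11) ∷ (11 , 0) ∷ (13 , 12) ∷
  (12 , 15) ∷ (14 , 15) ∷ (15 , 0) ∷ (16 , 0) ∷ (17 , 19) ∷ (18 , 19) ∷ (19 , 0) ∷ (21 , 20) ∷ (20 , 23) ∷ (22 , 23) ∷ (23 , 0) ∷ (24 , 25) ∷
  (25 , 26) ∷ (26 , 0) ∷ (27 , 31) ∷ (29 , 28) ∷ (28 , 31) ∷ (30 , 31) ∷ (31 , 0) ∷ (32 , 0) ∷ (33 , 35) ∷ (34 , 35) ∷ (35 , 0) ∷ (37 , 36) ∷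
  (36 , 39) ∷ (38 , 39) ∷ (39 , 0) ∷ (40 , 41) ∷ (41 , 42) ∷ (42 , 0) ∷ (43 , 47) ∷ (45 , 44) ∷ (44 , 47) ∷ (46 , 47) ∷ (47 , 0) ∷ (48 , 49) ∷
  (49 , 50) ∷ (50 , 0) ∷ (51 , 55) ∷ (53 , 52) ∷ (52 , 55) ∷ (54 , 55) ∷ (55 , 0) ∷ (56 , 57) ∷ (57 , 58) ∷ (59 , 58) ∷ (58 , 0) ∷ (61 , 60) ∷
  (62 , 63) ∷ (63 , 60) ∷ (60 , 0) ∷ (64 , 0) ∷ (65 , 67) ∷ (66 , 67) ∷ (67 , 0) ∷ (69 , 68) ∷ (68 , 71) ∷ (70 , 71) ∷ (71 , 0) ∷ (72 , 73) ∷
  (73 , 74) ∷ (74 , 0) ∷ (75 , 79) ∷ (77 , 76) ∷ (76 , 79) ∷ (78 , 79) ∷ (79 , 0) ∷ (80 , 81) ∷ (81 , 82) ∷ (82 , 0) ∷ (83 , 87) ∷ (85 , 84) ∷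
  (84 , 87) ∷ (86 , 87) ∷ (87 , 0) ∷ (88 , 89) ∷ (89 , 90) ∷ (91 , 90) ∷ (90 , 0) ∷ (93 , 92) ∷ (94 , 95) ∷ (95 , 92) ∷ (92 , 0) ∷ (96 , 97) ∷
  (97 , 98) ∷ (98 , 0) ∷ (99 , 103) ∷ (101 , 100) ∷ (100 , 103) ∷ (102 , 103) ∷ (103 , 0) ∷ (104 , 105) ∷ (105 , 106) ∷ (107 , 106) ∷ (106 , 0) ∷ (109 , 108) ∷
  (110 , 111) ∷ (111 , 108) ∷ (108 , 0) ∷ (112 , 113) ∷ (113 , 114) ∷ (114 , 117) ∷ (115 , 119) ∷ (116 , 117) ∷ (117 , 0) ∷ (118 , 119) ∷ (119 , 121) ∷ (120 , 121) ∷
  (121 , 0) ∷ (122 , 123) ∷ (123 , 125) ∷ (124 , 125) ∷ (127 , 126) ∷ (126 , 125) ∷ (125 , 0) ∷ (128 , 0) ∷ (129 , 131) ∷ (130 , 131) ∷ (131 , 0) ∷ (133 , 132) ∷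
  (132 , 135) ∷ (134 , 135) ∷ (135 , 0) ∷ (136 , 137) ∷ (137 , 138) ∷ (138 , 0) ∷ (139 , 143) ∷ (141 , 140) ∷ (140 , 143) ∷ (142 , 143) ∷ (143 , 0) ∷ (144 , 145) ∷
  (145 , 146) ∷ (146 , 0) ∷ (147 , 151) ∷ (149 , 148) ∷ (148 , 151) ∷ (150 , 151) ∷ (151 , 0) ∷ (152 , 153) ∷ (153 , 154) ∷ (155 , 154) ∷ (154 , 0) ∷ (157 , 156) ∷
  (158 , 159) ∷ (159 , 156) ∷ (156 , 0) ∷ (160 , 161) ∷ (161 , 162) ∷ (162 , 0) ∷ (163 , 167) ∷ (165 , 164) ∷ (164 , 167) ∷ (166 , 167) ∷ (167 , 0) ∷ (168 , 169) ∷
  (169 , 170) ∷ (171 , 170) ∷ (170 , 0) ∷ (173 , 172) ∷ (174 , 175) ∷ (175 , 172) ∷ (172 , 0) ∷ (176 , 177) ∷ (177 , 178) ∷ (178 , 181) ∷ (179 , 183) ∷ (180 , 181) ∷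
  (181 , 0) ∷ (182 , 183) ∷ (183 , 185) ∷ (184 , 185) ∷ (185 , 0) ∷ (186 , 187) ∷ (187 , 189) ∷ (188 , 189) ∷ (191 , 190) ∷ (190 , 189) ∷ (189 , 0) ∷ (192 , 193) ∷
  (193 , 194) ∷ (194 , 0) ∷ (195 , 199) ∷ (197 , 196) ∷ (196 , 199) ∷ (198 , 199) ∷ (199 , 0) ∷ (200 , 201) ∷ (201 , 202) ∷ (203 , 202) ∷ (202 , 0) ∷ (205 , 204) ∷
  (206 , 207) ∷ (207 , 204) ∷ (204 , 0) ∷ (208 , 209) ∷ (209 , 210) ∷ (210 , 213) ∷ (211 , 215) ∷ (212 , 213) ∷ (213 , 0) ∷ (214 , 215) ∷ (215 , 217) ∷ (216 , 217) ∷
  (217 , 0) ∷ (218 , 219) ∷ (219 , 221) ∷ (220 , 221) ∷ (223 , 222) ∷ (222 , 221) ∷ (221 , 0) ∷ (224 , 225) ∷ (225 , 226) ∷ (226 , 229) ∷ (227 , 231) ∷ (228 , 229) ∷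
  (229 , 0) ∷ (230 , 231) ∷ (231 , 233) ∷ (232 , 233) ∷ (233 , 0) ∷ (234 , 235) ∷ (235 , 237) ∷ (236 , 237) ∷ (239 , 238) ∷ (238 , 237) ∷ (237 , 0) ∷ (240 , 241) ∷
  (241 , 242) ∷ (242 , 245) ∷ (243 , 247) ∷ (245 , 250) ∷ (246 , 244) ∷ (247 , 244) ∷ (249 , 248) ∷ (251 , 250) ∷ (250 , 0) ∷ (252 , 244) ∷ (244 , 0) ∷ (253 , 255) ∷
  (254 , 255) ∷ (255 , 248) ∷ (248 , 0) ∷ (256 , 0) ∷ (257 , 259) ∷ (258 , 259) ∷ (259 , 0) ∷ (261 , 260) ∷ (260 , 263) ∷ (262 , 263) ∷ (263 , 0) ∷ (264 , 265) ∷
  (265 , 266) ∷ (266 , 0) ∷ (267 , 271) ∷ (269 , 268) ∷ (268 , 271) ∷ (270 , 271) ∷ (271 , 0) ∷ (272 , 273) ∷ (273 , 274) ∷ (274 , 0) ∷ (275 , 279) ∷ (277 , 276) ∷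
  (276 , 279) ∷ (278 , 279) ∷ (279 , 0) ∷ (280 , 281) ∷ (281 , 282) ∷ (283 , 282) ∷ (282 , 0) ∷ (285 , 284) ∷ (286 , 287) ∷ (287 , 284) ∷ (284 , 0) ∷ (288 , 289) ∷
  (289 , 290) ∷ (290 , 0) ∷ (291 , 295) ∷ (293 , 292) ∷ (292 , 295) ∷ (294 , 295) ∷ (295 , 0) ∷ (296 , 297) ∷ (297 , 298) ∷ (299 , 298) ∷ (298 , 0) ∷ (301 , 300) ∷
  (302 , 303) ∷ (303 , 300) ∷ (300 , 0) ∷ (304 , 305) ∷ (305 , 306) ∷ (306 , 309) ∷ (307 , 311) ∷ (308 , 309) ∷ (309 , 0) ∷ (310 , 311) ∷ (311 , 313) ∷ (312 , 313) ∷
  (313 , 0) ∷ (314 , 315) ∷ (315 , 317) ∷ (316 , 317) ∷ (319 , 318) ∷ (318 , 317) ∷ (317 , 0) ∷ (320 , 321) ∷ (321 , 322) ∷ (322 , 0) ∷ (323 , 327) ∷ (325 , 324) ∷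
  (324 , 327) ∷ (326 , 327) ∷ (327 , 0) ∷ (328 , 329) ∷ (329 , 330) ∷ (331 , 330) ∷ (330 , 0) ∷ (333 , 332) ∷ (334 , 335) ∷ (335 , 332) ∷ (332 , 0) ∷ (336 , 337) ∷
  (337 , 338) ∷ (338 , 341) ∷ (339 , 343) ∷ (340 , 341) ∷ (341 , 0) ∷ (342 , 343) ∷ (343 , 345) ∷ (344 , 345) ∷ (345 , 0) ∷ (346 , 347) ∷ (347 , 349) ∷ (348 , 349) ∷
  (351 , 350) ∷ (350 , 349) ∷ (349 , 0) ∷ (352 , 353) ∷ (353 , 354) ∷ (354 , 357) ∷ (355 , 359) ∷ (356 , 357) ∷ (357 , 0) ∷ (358 , 359) ∷ (359 , 361) ∷ (360 , 361) ∷
  (361 , 0) ∷ (362 , 363) ∷ (363 , 365) ∷ (364 , 365) ∷ (367 , 366) ∷ (366 , 365) ∷ (365 , 0) ∷ (368 , 369) ∷ (369 , 370) ∷ (370 , 373) ∷ (371 , 375) ∷ (373 , 378) ∷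
  (374 , 372) ∷ (375 , 372) ∷ (377 , 376) ∷ (379 , 378) ∷ (378 , 0) ∷ (380 , 372) ∷ (372 , 0) ∷ (381 , 383) ∷ (382 , 383) ∷ (383 , 376) ∷ (376 , 0) ∷ (384 , 385) ∷
  (385 , 386) ∷ (386 , 0) ∷ (387 , 391) ∷ (389 , 388) ∷ (388 , 391) ∷ (390 , 391) ∷ (391 , 0) ∷ (392 , 393) ∷ (393 , 394) ∷ (395 , 394) ∷ (394 , 0) ∷ (397 , 396) ∷
  (398 , 399) ∷ (399 , 396) ∷ (396 , 0) ∷ (400 , 401) ∷ (401 , 402) ∷ (402 , 405) ∷ (403 , 407) ∷ (404 , 405) ∷ (405 , 0) ∷ (406 , 407) ∷ (407 , 409) ∷ (408 , 409) ∷
  (409 , 0) ∷ (410 , 411) ∷ (411 , 413) ∷ (412 , 413) ∷ (415 , 414) ∷ (414 , 413) ∷ (413 , 0) ∷ (416 , 417) ∷ (417 , 418) ∷ (418 , 421) ∷ (419 , 423) ∷ (420 , 421) ∷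
  (421 , 0) ∷ (422 , 423) ∷ (423 , 425) ∷ (424 , 425) ∷ (425 , 0) ∷ (426 , 427) ∷ (427 , 429) ∷ (428 , 429) ∷ (431 , 430) ∷ (430 , 429) ∷ (429 , 0) ∷ (432 , 433) ∷
  (433 , 434) ∷ (434 , 437) ∷ (435 , 439) ∷ (437 , 442) ∷ (438 , 436) ∷ (439 , 436) ∷ (441 , 440) ∷ (443 , 442) ∷ (442 , 0) ∷ (444 , 436) ∷ (436 , 0) ∷ (445 , 447) ∷
  (446 , 447) ∷ (447 , 440) ∷ (440 , 0) ∷ (448 , 449) ∷ (449 , 450) ∷ (450 , 453) ∷ (451 , 455) ∷ (452 , 453) ∷ (453 , 0) ∷ (454 , 455) ∷ (455 , 457) ∷ (456 , 457) ∷
  (457 , 0) ∷ (458 , 459) ∷ (459 , 461) ∷ (460 , 461) ∷ (463 , 462) ∷ (462 , 461) ∷ (461 , 0) ∷ (464 , 465) ∷ (465 , 466) ∷ (466 , 469) ∷ (467 , 471) ∷ (469 , 474) ∷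
  (470 , 468) ∷ (471 , 468) ∷ (473 , 472) ∷ (475 , 474) ∷ (474 , 0) ∷ (476 , 468) ∷ (468 , 0) ∷ (477 , 479) ∷ (478 , 479) ∷ (479 , 472) ∷ (472 , 0) ∷ (480 , 481) ∷
  (481 , 482) ∷ (482 , 485) ∷ (483 , 487) ∷ (485 , 490) ∷ (486 , 484) ∷ (487 , 484) ∷ (489 , 488) ∷ (491 , 490) ∷ (490 , 0) ∷ (492 , 484) ∷ (484 , 0) ∷ (493 , 495) ∷
  (494 , 495) ∷ (495 , 488) ∷ (488 , 0) ∷ (496 , 497) ∷ (497 , 503) ∷ (499 , 498) ∷ (498 , 503) ∷ (501 , 500) ∷ (500 , 503) ∷ (502 , 503) ∷ (503 , 0) ∷ (504 , 505) ∷
  (505 , 506) ∷ (506 , 509) ∷ (508 , 510) ∷ (510 , 509) ∷ (511 , 507) ∷ (507 , 509) ∷ (509 , 0) ∷ (512 , 0) ∷ (513 , 515) ∷ (514 , 515) ∷ (515 , 0) ∷ (517 , 516) ∷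
  (516 , 519) ∷ (518 , 519) ∷ (519 , 0) ∷ (520 , 521) ∷ (521 , 522) ∷ (522 , 0) ∷ (523 , 527) ∷ (525 , 524) ∷ (524 , 527) ∷ (526 , 527) ∷ (527 , 0) ∷ (528 , 529) ∷
  (529 , 530) ∷ (530 , 0) ∷ (531 , 535) ∷ (533 , 532) ∷ (532 , 535) ∷ (534 , 535) ∷ (535 , 0) ∷ (536 , 537) ∷ (537 , 538) ∷ (539 , 538) ∷ (538 , 0) ∷ (541 , 540) ∷
  (542 , 543) ∷ (543 , 540) ∷ (540 , 0) ∷ (544 , 545) ∷ (545 , 546) ∷ (546 , 0) ∷ (547 , 551) ∷ (549 , 548) ∷ (548 , 551) ∷ (550 , 551) ∷ (551 , 0) ∷ (552 , 553) ∷
  (553 , 554) ∷ (555 , 554) ∷ (554 , 0) ∷ (557 , 556) ∷ (558 , 559) ∷ (559 , 556) ∷ (556 , 0) ∷ (560 , 561) ∷ (561 , 562) ∷ (562 , 565) ∷ (563 , 567) ∷ (564 , 565) ∷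
  (565 , 0) ∷ (566 , 567) ∷ (567 , 569) ∷ (568 , 569) ∷ (569 , 0) ∷ (570 , 571) ∷ (571 , 573) ∷ (572 , 573) ∷ (575 , 574) ∷ (574 , 573) ∷ (573 , 0) ∷ (576 , 577) ∷
  (577 , 578) ∷ (578 , 0) ∷ (579 , 583) ∷ (581 , 580) ∷ (580 , 583) ∷ (582 , 583) ∷ (583 , 0) ∷ (584 , 585) ∷ (585 , 586) ∷ (587 , 586) ∷ (586 , 0) ∷ (589 , 588) ∷
  (590 , 591) ∷ (591 , 588) ∷ (588 , 0) ∷ (592 , 593) ∷ (593 , 594) ∷ (594 , 597) ∷ (595 , 599) ∷ (596 , 597) ∷ (597 , 0) ∷ (598 , 599) ∷ (599 , 601) ∷ (600 , 601) ∷
  (601 , 0) ∷ (602 , 603) ∷ (603 , 605) ∷ (604 , 605) ∷ (607 , 606) ∷ (606 , 605) ∷ (605 , 0) ∷ (608 , 609) ∷ (609 , 610) ∷ (610 , 613) ∷ (611 , 615) ∷ (612 , 613) ∷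
  (613 , 0) ∷ (614 , 615) ∷ (615 , 617) ∷ (616 , 617) ∷ (617 , 0) ∷ (618 , 619) ∷ (619 , 621) ∷ (620 , 621) ∷ (623 , 622) ∷ (622 , 621) ∷ (621 , 0) ∷ (624 , 625) ∷
  (625 , 626) ∷ (626 , 629) ∷ (627 , 631) ∷ (629 , 634) ∷ (630 , 628) ∷ (631 , 628) ∷ (633 , 632) ∷ (635 , 634) ∷ (634 , 0) ∷ (636 , 628) ∷ (628 , 0) ∷ (637 , 639) ∷
  (638 , 639) ∷ (639 , 632) ∷ (632 , 0) ∷ (640 , 641) ∷ (641 , 642) ∷ (642 , 0) ∷ (643 , 647) ∷ (645 , 644) ∷ (644 , 647) ∷ (646 , 647) ∷ (647 , 0) ∷ (648 , 649) ∷
  (649 , 650) ∷ (651 , 650) ∷ (650 , 0) ∷ (653 , 652) ∷ (654 , 655) ∷ (655 , 652) ∷ (652 , 0) ∷ (656 , 657) ∷ (657 , 658) ∷ (658 , 661) ∷ (659 , 663) ∷ (660 , 661) ∷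
  (661 , 0) ∷ (662 , 663) ∷ (663 , 665) ∷ (664 , 665) ∷ (665 , 0) ∷ (666 , 667) ∷ (667 , 669) ∷ (668 , 669) ∷ (671 , 670) ∷ (670 , 669) ∷ (669 , 0) ∷ (672 , 673) ∷
  (673 , 674) ∷ (674 , 677) ∷ (675 , 679) ∷ (676 , 677) ∷ (677 , 0) ∷ (678 , 679) ∷ (679 , 681) ∷ (680 , 681) ∷ (681 , 0) ∷ (682 , 683) ∷ (683 , 685) ∷ (684 , 685) ∷
  (687 , 686) ∷ (686 , 685) ∷ (685 , 0) ∷ (688 , 689) ∷ (689 , 690) ∷ (690 , 693) ∷ (691 , 695) ∷ (693 , 698) ∷ (694 , 692) ∷ (695 , 692) ∷ (697 , 696) ∷ (699 , 698) ∷
  (698 , 0) ∷ (700 , 692) ∷ (692 , 0) ∷ (701 , 703) ∷ (702 , 703) ∷ (703 , 696) ∷ (696 , 0) ∷ (704 , 705) ∷ (705 , 706) ∷ (706 , 709) ∷ (707 , 711) ∷ (708 , 709) ∷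
  (709 , 0) ∷ (710 , 711) ∷ (711 , 713) ∷ (712 , 713) ∷ (713 , 0) ∷ (714 , 715) ∷ (715 , 717) ∷ (716 , 717) ∷ (719 , 718) ∷ (718 , 717) ∷ (717 , 0) ∷ (720 , 721) ∷
  (721 , 722) ∷ (722 , 725) ∷ (723 , 727) ∷ (725 , 730) ∷ (726 , 724) ∷ (727 , 724) ∷ (729 , 728) ∷ (731 , 730) ∷ (730 , 0) ∷ (732 , 724) ∷ (724 , 0) ∷ (733 , 735) ∷
  (734 , 735) ∷ (735 , 728) ∷ (728 , 0) ∷ (736 , 737) ∷ (737 , 738) ∷ (738 , 741) ∷ (739 , 743) ∷ (741 , 746) ∷ (742 , 740) ∷ (743 , 740) ∷ (745 , 744) ∷ (747 , 746) ∷
  (746 , 0) ∷ (748 , 740) ∷ (740 , 0) ∷ (749 , 751) ∷ (750 , 751) ∷ (751 , 744) ∷ (744 , 0) ∷ (752 , 753) ∷ (753 , 759) ∷ (755 , 754) ∷ (754 , 759) ∷ (757 , 756) ∷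
  (756 , 759) ∷ (758 , 759) ∷ (759 , 0) ∷ (760 , 761) ∷ (761 , 762) ∷ (762 , 765) ∷ (764 , 766) ∷ (766 , 765) ∷ (767 , 763) ∷ (763 , 765) ∷ (765 , 0) ∷ (768 , 769) ∷
  (769 , 770) ∷ (770 , 0) ∷ (771 , 775) ∷ (773 , 772) ∷ (772 , 775) ∷ (774 , 775) ∷ (775 , 0) ∷ (776 , 777) ∷ (777 , 778) ∷ (779 , 778) ∷ (778 , 0) ∷ (781 , 780) ∷
  (782 , 783) ∷ (783 , 780) ∷ (780 , 0) ∷ (784 , 785) ∷ (785 , 786) ∷ (786 , 789) ∷ (787 , 791) ∷ (788 , 789) ∷ (789 , 0) ∷ (790 , 791) ∷ (791 , 793) ∷ (792 , 793) ∷
  (793 , 0) ∷ (794 , 795) ∷ (795 , 797) ∷ (796 , 797) ∷ (799 , 798) ∷ (798 , 797) ∷ (797 , 0) ∷ (800 , 801) ∷ (801 , 802) ∷ (802 , 805) ∷ (803 , 807) ∷ (804 , 805) ∷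
  (805 , 0) ∷ (806 , 807) ∷ (807 , 809) ∷ (808 , 809) ∷ (809 , 0) ∷ (810 , 811) ∷ (811 , 813) ∷ (812 , 813) ∷ (815 , 814) ∷ (814 , 813) ∷ (813 , 0) ∷ (816 , 817) ∷
  (817 , 818) ∷ (818 , 821) ∷ (819 , 823) ∷ (821 , 826) ∷ (822 , 820) ∷ (823 , 820) ∷ (825 , 824) ∷ (827 , 826) ∷ (826 , 0) ∷ (828 , 820) ∷ (820 , 0) ∷ (829 , 831) ∷
  (830 , 831) ∷ (831 , 824) ∷ (824 , 0) ∷ (832 , 833) ∷ (833 , 834) ∷ (834 , 837) ∷ (835 , 839) ∷ (836 , 837) ∷ (837 , 0) ∷ (838 , 839) ∷ (839 , 841) ∷ (840 , 841) ∷
  (841 , 0) ∷ (842 , 843) ∷ (843 , 845) ∷ (844 , 845) ∷ (847 , 846) ∷ (846 , 845) ∷ (845 , 0) ∷ (848 , 849) ∷ (849 , 850) ∷ (850 , 853) ∷ (851 , 855) ∷ (853 , 858) ∷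
  (854 , 852) ∷ (855 , 852) ∷ (857 , 856) ∷ (859 , 858) ∷ (858 , 0) ∷ (860 , 852) ∷ (852 , 0) ∷ (861 , 863) ∷ (862 , 863) ∷ (863 , 856) ∷ (856 , 0) ∷ (864 , 865) ∷
  (865 , 866) ∷ (866 , 869) ∷ (867 , 871) ∷ (869 , 874) ∷ (870 , 868) ∷ (871 , 868) ∷ (873 , 872) ∷ (875 , 874) ∷ (874 , 0) ∷ (876 , 868) ∷ (868 , 0) ∷ (877 , 879) ∷
  (878 , 879) ∷ (879 , 872) ∷ (872 , 0) ∷ (880 , 881) ∷ (881 , 887) ∷ (883 , 882) ∷ (882 , 887) ∷ (885 , 884) ∷ (884 , 887) ∷ (886 , 887) ∷ (887 , 0) ∷ (888 , 889) ∷
  (889 , 890) ∷ (890 , 893) ∷ (892 , 894) ∷ (894 , 893) ∷ (895 , 891) ∷ (891 , 893) ∷ (893 , 0) ∷ (896 , 897) ∷ (897 , 898) ∷ (898 , 901) ∷ (899 , 903) ∷ (900 , 901) ∷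
  (901 , 0) ∷ (902 , 903) ∷ (903 , 905) ∷ (904 , 905) ∷ (905 , 0) ∷ (906 , 907) ∷ (907 , 909) ∷ (908 , 909) ∷ (911 , 910) ∷ (910 , 909) ∷ (909 , 0) ∷ (912 , 913) ∷
  (913 , 914) ∷ (914 , 917) ∷ (915 , 919) ∷ (917 , 922) ∷ (918 , 916) ∷ (919 , 916) ∷ (921 , 920) ∷ (923 , 922) ∷ (922 , 0) ∷ (924 , 916) ∷ (916 , 0) ∷ (925 , 927) ∷
  (926 , 927) ∷ (927 , 920) ∷ (920 , 0) ∷ (928 , 929) ∷ (929 , 930) ∷ (930 , 933) ∷ (931 , 935) ∷ (933 , 938) ∷ (934 , 932) ∷ (935 , 932) ∷ (937 , 936) ∷ (939 , 938) ∷
  (938 , 0) ∷ (940 , 932) ∷ (932 , 0) ∷ (941 , 943) ∷ (942 , 943) ∷ (943 , 936) ∷ (936 , 0) ∷ (944 , 945) ∷ (945 , 951) ∷ (947 , 946) ∷ (946 , 951) ∷ (949 , 948) ∷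
  (948 , 951) ∷ (950 , 951) ∷ (951 , 0) ∷ (952 , 953) ∷ (953 , 954) ∷ (954 , 957) ∷ (956 , 958) ∷ (958 , 957) ∷ (959 , 955) ∷ (955 , 957) ∷ (957 , 0) ∷ (960 , 961) ∷
  (961 , 962) ∷ (962 , 965) ∷ (963 , 967) ∷ (965 , 970) ∷ (966 , 964) ∷ (967 , 964) ∷ (969 , 968) ∷ (971 , 970) ∷ (970 , 0) ∷ (972 , 964) ∷ (964 , 0) ∷ (973 , 975) ∷
  (974 , 975) ∷ (975 , 968) ∷ (968 , 0) ∷ (976 , 977) ∷ (977 , 983) ∷ (979 , 978) ∷ (978 , 983) ∷ (981 , 980) ∷ (980 , 983) ∷ (982 , 983) ∷ (983 , 0) ∷ (984 , 985) ∷
  (985 , 986) ∷ (986 , 989) ∷ (988 , 990) ∷ (990 , 989) ∷ (991 , 987) ∷ (987 , 989) ∷ (989 , 0) ∷ (992 , 993) ∷ (993 , 999) ∷ (995 , 994) ∷ (994 , 999) ∷ (997 , 996) ∷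
  (996 , 999) ∷ (998 , 999) ∷ (999 , 0) ∷ (1000 , 1001) ∷ (1001 , 1002) ∷ (1002 , 1005) ∷ (1004 , 1006) ∷ (1006 , 1005) ∷ (1007 , 1003) ∷ (1003 , 1005) ∷ (1005 , 0) ∷ (1008 , 1009) ∷
  (1009 , 1010) ∷ (1010 , 1013) ∷ (1012 , 1014) ∷ (1014 , 1013) ∷ (1015 , 1011) ∷ (1011 , 1013) ∷ (1013 , 0) ∷ (1016 , 1017) ∷ (1017 , 1018) ∷ (1019 , 1018) ∷ (1020 , 1021) ∷ (1022 , 1018) ∷
  (1023 , 1021) ∷ (1021 , 1018) ∷ (1018 , 0) ∷ (1024 , 0) ∷ (1025 , 1027) ∷ (1026 , 1027) ∷ (1027 , 0) ∷ (1029 , 1028) ∷ (1028 , 1031) ∷ (1030 , 1031) ∷ (1031 , 0) ∷ (1032 , 1033) ∷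
  (1033 , 1034) ∷ (1034 , 0) ∷ (1035 , 1039) ∷ (1037 , 1036) ∷ (1036 , 1039) ∷ (1038 , 1039) ∷ (1039 , 0) ∷ (1040 , 1041) ∷ (1041 , 1042) ∷ (1042 , 0) ∷ (1043 , 1047) ∷ (1045 , 1044) ∷
  (1044 , 1047) ∷ (1046 , 1047) ∷ (1047 , 0) ∷ (1048 , 1049) ∷ (1049 , 1050) ∷ (1051 , 1050) ∷ (1050 , 0) ∷ (1053 , 1052) ∷ (1054 , 1055) ∷ (1055 , 1052) ∷ (1052 , 0) ∷ (1056 , 1057) ∷
  (1057 , 1058) ∷ (1058 , 0) ∷ (1059 , 1063) ∷ (1061 , 1060) ∷ (1060 , 1063) ∷ (1062 , 1063) ∷ (1063 , 0) ∷ (1064 , 1065) ∷ (1065 , 1066) ∷ (1067 , 1066) ∷ (1066 , 0) ∷ (1069 , 1068) ∷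
  (1070 , 1071) ∷ (1071 , 1068) ∷ (1068 , 0) ∷ (1072 , 1073) ∷ (1073 , 1074) ∷ (1074 , 1077) ∷ (1075 , 1079) ∷ (1076 , 1077) ∷ (1077 , 0) ∷ (1078 , 1079) ∷ (1079 , 1081) ∷ (1080 , 1081) ∷
  (1081 , 0) ∷ (1082 , 1083) ∷ (1083 , 1085) ∷ (1084 , 1085) ∷ (1087 , 1086) ∷ (1086 , 1085) ∷ (1085 , 0) ∷ (1088 , 1089) ∷ (1089 , 1090) ∷ (1090 , 0) ∷ (1091 , 1095) ∷ (1093 , 1092) ∷
  (1092 , 1095) ∷ (1094 , 1095) ∷ (1095 , 0) ∷ (1096 , 1097) ∷ (1097 , 1098) ∷ (1099 , 1098) ∷ (1098 , 0) ∷ (1101 , 1100) ∷ (1102 , 1103) ∷ (1103 , 1100) ∷ (1100 , 0) ∷ (1104 , 1105) ∷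
  (1105 , 1106) ∷ (1106 , 1109) ∷ (1107 , 1111) ∷ (1108 , 1109) ∷ (1109 , 0) ∷ (1110 , 1111) ∷ (1111 , 1113) ∷ (1112 , 1113) ∷ (1113 , 0) ∷ (1114 , 1115) ∷ (1115 , 1117) ∷ (1116 , 1117) ∷
  (1119 , 1118) ∷ (1118 , 1117) ∷ (1117 , 0) ∷ (1120 , 1121) ∷ (1121 , 1122) ∷ (1122 , 1125) ∷ (1123 , 1127) ∷ (1124 , 1125) ∷ (1125 , 0) ∷ (1126 , 1127) ∷ (1127 , 1129) ∷ (1128 , 1129) ∷
  (1129 , 0) ∷ (1130 , 1131) ∷ (1131 , 1133) ∷ (1132 , 1133) ∷ (1135 , 1134) ∷ (1134 , 1133) ∷ (1133 , 0) ∷ (1136 , 1137) ∷ (1137 , 1138) ∷ (1138 , 1141) ∷ (1139 , 1143) ∷ (1141 , 1146) ∷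
  (1142 , 1140) ∷ (1143 , 1140) ∷ (1145 , 1144) ∷ (1147 , 1146) ∷ (1146 , 0) ∷ (1148 , 1140) ∷ (1140 , 0) ∷ (1149 , 1151) ∷ (1150 , 1151) ∷ (1151 , 1144) ∷ (1144 , 0) ∷ (1152 , 1153) ∷
  (1153 , 1154) ∷ (1154 , 0) ∷ (1155 , 1159) ∷ (1157 , 1156) ∷ (1156 , 1159) ∷ (1158 , 1159) ∷ (1159 , 0) ∷ (1160 , 1161) ∷ (1161 , 1162) ∷ (1163 , 1162) ∷ (1162 , 0) ∷ (1165 , 1164) ∷
  (1166 , 1167) ∷ (1167 , 1164) ∷ (1164 , 0) ∷ (1168 , 1169) ∷ (1169 , 1170) ∷ (1170 , 1173) ∷ (1171 , 1175) ∷ (1172 , 1173) ∷ (1173 , 0) ∷ (1174 , 1175) ∷ (1175 , 1177) ∷ (1176 , 1177) ∷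
  (1177 , 0) ∷ (1178 , 1179) ∷ (1179 , 1181) ∷ (1180 , 1181) ∷ (1183 , 1182) ∷ (1182 , 1181) ∷ (1181 , 0) ∷ (1184 , 1185) ∷ (1185 , 1186) ∷ (1186 , 1189) ∷ (1187 , 1191) ∷ (1188 , 1189) ∷
  (1189 , 0) ∷ (1190 , 1191) ∷ (1191 , 1193) ∷ (1192 , 1193) ∷ (1193 , 0) ∷ (1194 , 1195) ∷ (1195 , 1197) ∷ (1196 , 1197) ∷ (1199 , 1198) ∷ (1198 , 1197) ∷ (1197 , 0) ∷ (1200 , 1201) ∷
  (1201 , 1202) ∷ (1202 , 1205) ∷ (1203 , 1207) ∷ (1205 , 1210) ∷ (1206 , 1204) ∷ (1207 , 1204) ∷ (1209 , 1208) ∷ (1211 , 1210) ∷ (1210 , 0) ∷ (1212 , 1204) ∷ (1204 , 0) ∷ (1213 , 1215) ∷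
  (1214 , 1215) ∷ (1215 , 1208) ∷ (1208 , 0) ∷ (1216 , 1217) ∷ (1217 , 1218) ∷ (1218 , 1221) ∷ (1219 , 1223) ∷ (1220 , 1221) ∷ (1221 , 0) ∷ (1222 , 1223) ∷ (1223 , 1225) ∷ (1224 , 1225) ∷
  (1225 , 0) ∷ (1226 , 1227) ∷ (1227 , 1229) ∷ (1228 , 1229) ∷ (1231 , 1230) ∷ (1230 , 1229) ∷ (1229 , 0) ∷ (1232 , 1233) ∷ (1233 , 1234) ∷ (1234 , 1237) ∷ (1235 , 1239) ∷ (1237 , 1242) ∷
  (1238 , 1236) ∷ (1239 , 1236) ∷ (1241 , 1240) ∷ (1243 , 1242) ∷ (1242 , 0) ∷ (1244 , 1236) ∷ (1236 , 0) ∷ (1245 , 1247) ∷ (1246 , 1247) ∷ (1247 , 1240) ∷ (1240 , 0) ∷ (1248 , 1249) ∷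
  (1249 , 1250) ∷ (1250 , 1253) ∷ (1251 , 1255) ∷ (1253 , 1258) ∷ (1254 , 1252) ∷ (1255 , 1252) ∷ (1257 , 1256) ∷ (1259 , 1258) ∷ (1258 , 0) ∷ (1260 , 1252) ∷ (1252 , 0) ∷ (1261 , 1263) ∷
  (1262 , 1263) ∷ (1263 , 1256) ∷ (1256 , 0) ∷ (1264 , 1265) ∷ (1265 , 1271) ∷ (1267 , 1266) ∷ (1266 , 1271) ∷ (1269 , 1268) ∷ (1268 , 1271) ∷ (1270 , 1271) ∷ (1271 , 0) ∷ (1272 , 1273) ∷
  (1273 , 1274) ∷ (1274 , 1277) ∷ (1276 , 1278) ∷ (1278 , 1277) ∷ (1279 , 1275) ∷ (1275 , 1277) ∷ (1277 , 0) ∷ (1280 , 1281) ∷ (1281 , 1282) ∷ (1282 , 0) ∷ (1283 , 1287) ∷ (1285 , 1284) ∷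
  (1284 , 1287) ∷ (1286 , 1287) ∷ (1287 , 0) ∷ (1288 , 1289) ∷ (1289 , 1290) ∷ (1291 , 1290) ∷ (1290 , 0) ∷ (1293 , 1292) ∷ (1294 , 1295) ∷ (1295 , 1292) ∷ (1292 , 0) ∷ (1296 , 1297) ∷
  (1297 , 1298) ∷ (1298 , 1301) ∷ (1299 , 1303) ∷ (1300 , 1301) ∷ (1301 , 0) ∷ (1302 , 1303) ∷ (1303 , 1305) ∷ (1304 , 1305) ∷ (1305 , 0) ∷ (1306 , 1307) ∷ (1307 , 1309) ∷ (1308 , 1309) ∷
  (1311 , 1310) ∷ (1310 , 1309) ∷ (1309 , 0) ∷ (1312 , 1313) ∷ (1313 , 1314) ∷ (1314 , 1317) ∷ (1315 , 1319) ∷ (1316 , 1317) ∷ (1317 , 0) ∷ (1318 , 1319) ∷ (1319 , 1321) ∷ (1320 , 1321) ∷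
  (1321 , 0) ∷ (1322 , 1323) ∷ (1323 , 1325) ∷ (1324 , 1325) ∷ (1327 , 1326) ∷ (1326 , 1325) ∷ (1325 , 0) ∷ (1328 , 1329) ∷ (1329 , 1330) ∷ (1330 , 1333) ∷ (1331 , 1335) ∷ (1333 , 1338) ∷
  (1334 , 1332) ∷ (1335 , 1332) ∷ (1337 , 1336) ∷ (1339 , 1338) ∷ (1338 , 0) ∷ (1340 , 1332) ∷ (1332 , 0) ∷ (1341 , 1343) ∷ (1342 , 1343) ∷ (1343 , 1336) ∷ (1336 , 0) ∷ (1344 , 1345) ∷
  (1345 , 1346) ∷ (1346 , 1349) ∷ (1347 , 1351) ∷ (1348 , 1349) ∷ (1349 , 0) ∷ (1350 , 1351) ∷ (1351 , 1353) ∷ (1352 , 1353) ∷ (1353 , 0) ∷ (1354 , 1355) ∷ (1355 , 1357) ∷ (1356 , 1357) ∷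
  (1359 , 1358) ∷ (1358 , 1357) ∷ (1357 , 0) ∷ (1360 , 1361) ∷ (1361 , 1362) ∷ (1362 , 1365) ∷ (1363 , 1367) ∷ (1365 , 1370) ∷ (1366 , 1364) ∷ (1367 , 1364) ∷ (1369 , 1368) ∷ (1371 , 1370) ∷
  (1370 , 0) ∷ (1372 , 1364) ∷ (1364 , 0) ∷ (1373 , 1375) ∷ (1374 , 1375) ∷ (1375 , 1368) ∷ (1368 , 0) ∷ (1376 , 1377) ∷ (1377 , 1378) ∷ (1378 , 1381) ∷ (1379 , 1383) ∷ (1381 , 1386) ∷
  (1382 , 1380) ∷ (1383 , 1380) ∷ (1385 , 1384) ∷ (1387 , 1386) ∷ (1386 , 0) ∷ (1388 , 1380) ∷ (1380 , 0) ∷ (1389 , 1391) ∷ (1390 , 1391) ∷ (1391 , 1384) ∷ (1384 , 0) ∷ (1392 , 1393) ∷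
  (1393 , 1399) ∷ (1395 , 1394) ∷ (1394 , 1399) ∷ (1397 , 1396) ∷ (1396 , 1399) ∷ (1398 , 1399) ∷ (1399 , 0) ∷ (1400 , 1401) ∷ (1401 , 1402) ∷ (1402 , 1405) ∷ (1404 , 1406) ∷ (1406 , 1405) ∷
  (1407 , 1403) ∷ (1403 , 1405) ∷ (1405 , 0) ∷ (1408 , 1409) ∷ (1409 , 1410) ∷ (1410 , 1413) ∷ (1411 , 1415) ∷ (1412 , 1413) ∷ (1413 , 0) ∷ (1414 , 1415) ∷ (1415 , 1417) ∷ (1416 , 1417) ∷
  (1417 , 0) ∷ (1418 , 1419) ∷ (1419 , 1421) ∷ (1420 , 1421) ∷ (1423 , 1422) ∷ (1422 , 1421) ∷ (1421 , 0) ∷ (1424 , 1425) ∷ (1425 , 1426) ∷ (1426 , 1429) ∷ (1427 , 1431) ∷ (1429 , 1434) ∷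
  (1430 , 1428) ∷ (1431 , 1428) ∷ (1433 , 1432) ∷ (1435 , 1434) ∷ (1434 , 0) ∷ (1436 , 1428) ∷ (1428 , 0) ∷ (1437 , 1439) ∷ (1438 , 1439) ∷ (1439 , 1432) ∷ (1432 , 0) ∷ (1440 , 1441) ∷
  (1441 , 1442) ∷ (1442 , 1445) ∷ (1443 , 1447) ∷ (1445 , 1450) ∷ (1446 , 1444) ∷ (1447 , 1444) ∷ (1449 , 1448) ∷ (1451 , 1450) ∷ (1450 , 0) ∷ (1452 , 1444) ∷ (1444 , 0) ∷ (1453 , 1455) ∷
  (1454 , 1455) ∷ (1455 , 1448) ∷ (1448 , 0) ∷ (1456 , 1457) ∷ (1457 , 1463) ∷ (1459 , 1458) ∷ (1458 , 1463) ∷ (1461 , 1460) ∷ (1460 , 1463) ∷ (1462 , 1463) ∷ (1463 , 0) ∷ (1464 , 1465) ∷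
  (1465 , 1466) ∷ (1466 , 1469) ∷ (1468 , 1470) ∷ (1470 , 1469) ∷ (1471 , 1467) ∷ (1467 , 1469) ∷ (1469 , 0) ∷ (1472 , 1473) ∷ (1473 , 1474) ∷ (1474 , 1477) ∷ (1475 , 1479) ∷ (1477 , 1482) ∷
  (1478 , 1476) ∷ (1479 , 1476) ∷ (1481 , 1480) ∷ (1483 , 1482) ∷ (1482 , 0) ∷ (1484 , 1476) ∷ (1476 , 0) ∷ (1485 , 1487) ∷ (1486 , 1487) ∷ (1487 , 1480) ∷ (1480 , 0) ∷ (1488 , 1489) ∷
  (1489 , 1495) ∷ (1491 , 1490) ∷ (1490 , 1495) ∷ (1493 , 1492) ∷ (1492 , 1495) ∷ (1494 , 1495) ∷ (1495 , 0) ∷ (1496 , 1497) ∷ (1497 , 1498) ∷ (1498 , 1501) ∷ (1500 , 1502) ∷ (1502 , 1501) ∷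
  (1503 , 1499) ∷ (1499 , 1501) ∷ (1501 , 0) ∷ (1504 , 1505) ∷ (1505 , 1511) ∷ (1507 , 1506) ∷ (1506 , 1511) ∷ (1509 , 1508) ∷ (1508 , 1511) ∷ (1510 , 1511) ∷ (1511 , 0) ∷ (1512 , 1513) ∷
  (1513 , 1514) ∷ (1514 , 1517) ∷ (1516 , 1518) ∷ (1518 , 1517) ∷ (1519 , 1515) ∷ (1515 , 1517) ∷ (1517 , 0) ∷ (1520 , 1521) ∷ (1521 , 1522) ∷ (1522 , 1525) ∷ (1524 , 1526) ∷ (1526 , 1525) ∷
  (1527 , 1523) ∷ (1523 , 1525) ∷ (1525 , 0) ∷ (1528 , 1529) ∷ (1529 , 1530) ∷ (1531 , 1530) ∷ (1532 , 1533) ∷ (1534 , 1530) ∷ (1535 , 1533) ∷ (1533 , 1530) ∷ (1530 , 0) ∷ (1536 , 1537) ∷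
  (1537 , 1538) ∷ (1538 , 0) ∷ (1539 , 1543) ∷ (1541 , 1540) ∷ (1540 , 1543) ∷ (1542 , 1543) ∷ (1543 , 0) ∷ (1544 , 1545) ∷ (1545 , 1546) ∷ (1547 , 1546) ∷ (1546 , 0) ∷ (1549 , 1548) ∷
  (1550 , 1551) ∷ (1551 , 1548) ∷ (1548 , 0) ∷ (1552 , 1553) ∷ (1553 , 1554) ∷ (1554 , 1557) ∷ (1555 , 1559) ∷ (1556 , 1557) ∷ (1557 , 0) ∷ (1558 , 1559) ∷ (1559 , 1561) ∷ (1560 , 1561) ∷
  (1561 , 0) ∷ (1562 , 1563) ∷ (1563 , 1565) ∷ (1564 , 1565) ∷ (1567 , 1566) ∷ (1566 , 1565) ∷ (1565 , 0) ∷ (1568 , 1569) ∷ (1569 , 1570) ∷ (1570 , 1573) ∷ (1571 , 1575) ∷ (1572 , 1573) ∷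
  (1573 , 0) ∷ (1574 , 1575) ∷ (1575 , 1577) ∷ (1576 , 1577) ∷ (1577 , 0) ∷ (1578 , 1579) ∷ (1579 , 1581) ∷ (1580 , 1581) ∷ (1583 , 1582) ∷ (1582 , 1581) ∷ (1581 , 0) ∷ (1584 , 1585) ∷
  (1585 , 1586) ∷ (1586 , 1589) ∷ (1587 , 1591) ∷ (1589 , 1594) ∷ (1590 , 1588) ∷ (1591 , 1588) ∷ (1593 , 1592) ∷ (1595 , 1594) ∷ (1594 , 0) ∷ (1596 , 1588) ∷ (1588 , 0) ∷ (1597 , 1599) ∷
  (1598 , 1599) ∷ (1599 , 1592) ∷ (1592 , 0) ∷ (1600 , 1601) ∷ (1601 , 1602) ∷ (1602 , 1605) ∷ (1603 , 1607) ∷ (1604 , 1605) ∷ (1605 , 0) ∷ (1606 , 1607) ∷ (1607 , 1609) ∷ (1608 , 1609) ∷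
  (1609 , 0) ∷ (1610 , 1611) ∷ (1611 , 1613) ∷ (1612 , 1613) ∷ (1615 , 1614) ∷ (1614 , 1613) ∷ (1613 , 0) ∷ (1616 , 1617) ∷ (1617 , 1618) ∷ (1618 , 1621) ∷ (1619 , 1623) ∷ (1621 , 1626) ∷
  (1622 , 1620) ∷ (1623 , 1620) ∷ (1625 , 1624) ∷ (1627 , 1626) ∷ (1626 , 0) ∷ (1628 , 1620) ∷ (1620 , 0) ∷ (1629 , 1631) ∷ (1630 , 1631) ∷ (1631 , 1624) ∷ (1624 , 0) ∷ (1632 , 1633) ∷
  (1633 , 1634) ∷ (1634 , 1637) ∷ (1635 , 1639) ∷ (1637 , 1642) ∷ (1638 , 1636) ∷ (1639 , 1636) ∷ (1641 , 1640) ∷ (1643 , 1642) ∷ (1642 , 0) ∷ (1644 , 1636) ∷ (1636 , 0) ∷ (1645 , 1647) ∷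
  (1646 , 1647) ∷ (1647 , 1640) ∷ (1640 , 0) ∷ (1648 , 1649) ∷ (1649 , 1655) ∷ (1651 , 1650) ∷ (1650 , 1655) ∷ (1653 , 1652) ∷ (1652 , 1655) ∷ (1654 , 1655) ∷ (1655 , 0) ∷ (1656 , 1657) ∷
  (1657 , 1658) ∷ (1658 , 1661) ∷ (1660 , 1662) ∷ (1662 , 1661) ∷ (1663 , 1659) ∷ (1659 , 1661) ∷ (1661 , 0) ∷ (1664 , 1665) ∷ (1665 , 1666) ∷ (1666 , 1669) ∷ (1667 , 1671) ∷ (1668 , 1669) ∷
  (1669 , 0) ∷ (1670 , 1671) ∷ (1671 , 1673) ∷ (1672 , 1673) ∷ (1673 , 0) ∷ (1674 , 1675) ∷ (1675 , 1677) ∷ (1676 , 1677) ∷ (1679 , 1678) ∷ (1678 , 1677) ∷ (1677 , 0) ∷ (1680 , 1681) ∷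
  (1681 , 1682) ∷ (1682 , 1685) ∷ (1683 , 1687) ∷ (1685 , 1690) ∷ (1686 , 1684) ∷ (1687 , 1684) ∷ (1689 , 1688) ∷ (1691 , 1690) ∷ (1690 , 0) ∷ (1692 , 1684) ∷ (1684 , 0) ∷ (1693 , 1695) ∷
  (1694 , 1695) ∷ (1695 , 1688) ∷ (1688 , 0) ∷ (1696 , 1697) ∷ (1697 , 1698) ∷ (1698 , 1701) ∷ (1699 , 1703) ∷ (1701 , 1706) ∷ (1702 , 1700) ∷ (1703 , 1700) ∷ (1705 , 1704) ∷ (1707 , 1706) ∷
  (1706 , 0) ∷ (1708 , 1700) ∷ (1700 , 0) ∷ (1709 , 1711) ∷ (1710 , 1711) ∷ (1711 , 1704) ∷ (1704 , 0) ∷ (1712 , 1713) ∷ (1713 , 1719) ∷ (1715 , 1714) ∷ (1714 , 1719) ∷ (1717 , 1716) ∷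
  (1716 , 1719) ∷ (1718 , 1719) ∷ (1719 , 0) ∷ (1720 , 1721) ∷ (1721 , 1722) ∷ (1722 , 1725) ∷ (1724 , 1726) ∷ (1726 , 1725) ∷ (1727 , 1723) ∷ (1723 , 1725) ∷ (1725 , 0) ∷ (1728 , 1729) ∷
  (1729 , 1730) ∷ (1730 , 1733) ∷ (1731 , 1735) ∷ (1733 , 1738) ∷ (1734 , 1732) ∷ (1735 , 1732) ∷ (1737 , 1736) ∷ (1739 , 1738) ∷ (1738 , 0) ∷ (1740 , 1732) ∷ (1732 , 0) ∷ (1741 , 1743) ∷
  (1742 , 1743) ∷ (1743 , 1736) ∷ (1736 , 0) ∷ (1744 , 1745) ∷ (1745 , 1751) ∷ (1747 , 1746) ∷ (1746 , 1751) ∷ (1749 , 1748) ∷ (1748 , 1751) ∷ (1750 , 1751) ∷ (1751 , 0) ∷ (1752 , 1753) ∷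
  (1753 , 1754) ∷ (1754 , 1757) ∷ (1756 , 1758) ∷ (1758 , 1757) ∷ (1759 , 1755) ∷ (1755 , 1757) ∷ (1757 , 0) ∷ (1760 , 1761) ∷ (1761 , 1767) ∷ (1763 , 1762) ∷ (1762 , 1767) ∷ (1765 , 1764) ∷
  (1764 , 1767) ∷ (1766 , 1767) ∷ (1767 , 0) ∷ (1768 , 1769) ∷ (1769 , 1770) ∷ (1770 , 1773) ∷ (1772 , 1774) ∷ (1774 , 1773) ∷ (1775 , 1771) ∷ (1771 , 1773) ∷ (1773 , 0) ∷ (1776 , 1777) ∷
  (1777 , 1778) ∷ (1778 , 1781) ∷ (1780 , 1782) ∷ (1782 , 1781) ∷ (1783 , 1779) ∷ (1779 , 1781) ∷ (1781 , 0) ∷ (1784 , 1785) ∷ (1785 , 1786) ∷ (1787 , 1786) ∷ (1788 , 1789) ∷ (1790 , 1786) ∷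
  (1791 , 1789) ∷ (1789 , 1786) ∷ (1786 , 0) ∷ (1792 , 1793) ∷ (1793 , 1794) ∷ (1794 , 1797) ∷ (1795 , 1799) ∷ (1796 , 1797) ∷ (1797 , 0) ∷ (1798 , 1799) ∷ (1799 , 1801) ∷ (1800 , 1801) ∷
  (1801 , 0) ∷ (1802 , 1803) ∷ (1803 , 1805) ∷ (1804 , 1805) ∷ (1807 , 1806) ∷ (1806 , 1805) ∷ (1805 , 0) ∷ (1808 , 1809) ∷ (1809 , 1810) ∷ (1810 , 1813) ∷ (1811 , 1815) ∷ (1813 , 1818) ∷
  (1814 , 1812) ∷ (1815 , 1812) ∷ (1817 , 1816) ∷ (1819 , 1818) ∷ (1818 , 0) ∷ (1820 , 1812) ∷ (1812 , 0) ∷ (1821 , 1823) ∷ (1822 , 1823) ∷ (1823 , 1816) ∷ (1816 , 0) ∷ (1824 , 1825) ∷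
  (1825 , 1826) ∷ (1826 , 1829) ∷ (1827 , 1831) ∷ (1829 , 1834) ∷ (1830 , 1828) ∷ (1831 , 1828) ∷ (1833 , 1832) ∷ (1835 , 1834) ∷ (1834 , 0) ∷ (1836 , 1828) ∷ (1828 , 0) ∷ (1837 , 1839) ∷
  (1838 , 1839) ∷ (1839 , 1832) ∷ (1832 , 0) ∷ (1840 , 1841) ∷ (1841 , 1847) ∷ (1843 , 1842) ∷ (1842 , 1847) ∷ (1845 , 1844) ∷ (1844 , 1847) ∷ (1846 , 1847) ∷ (1847 , 0) ∷ (1848 , 1849) ∷
  (1849 , 1850) ∷ (1850 , 1853) ∷ (1852 , 1854) ∷ (1854 , 1853) ∷ (1855 , 1851) ∷ (1851 , 1853) ∷ (1853 , 0) ∷ (1856 , 1857) ∷ (1857 , 1858) ∷ (1858 , 1861) ∷ (1859 , 1863) ∷ (1861 , 1866) ∷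
  (1862 , 1860) ∷ (1863 , 1860) ∷ (1865 , 1864) ∷ (1867 , 1866) ∷ (1866 , 0) ∷ (1868 , 1860) ∷ (1860 , 0) ∷ (1869 , 1871) ∷ (1870 , 1871) ∷ (1871 , 1864) ∷ (1864 , 0) ∷ (1872 , 1873) ∷
  (1873 , 1879) ∷ (1875 , 1874) ∷ (1874 , 1879) ∷ (1877 , 1876) ∷ (1876 , 1879) ∷ (1878 , 1879) ∷ (1879 , 0) ∷ (1880 , 1881) ∷ (1881 , 1882) ∷ (1882 , 1885) ∷ (1884 , 1886) ∷ (1886 , 1885) ∷
  (1887 , 1883) ∷ (1883 , 1885) ∷ (1885 , 0) ∷ (1888 , 1889) ∷ (1889 , 1895) ∷ (1891 , 1890) ∷ (1890 , 1895) ∷ (1893 , 1892) ∷ (1892 , 1895) ∷ (1894 , 1895) ∷ (1895 , 0) ∷ (1896 , 1897) ∷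
  (1897 , 1898) ∷ (1898 , 1901) ∷ (1900 , 1902) ∷ (1902 , 1901) ∷ (1903 , 1899) ∷ (1899 , 1901) ∷ (1901 , 0) ∷ (1904 , 1905) ∷ (1905 , 1906) ∷ (1906 , 1909) ∷ (1908 , 1910) ∷ (1910 , 1909) ∷
  (1911 , 1907) ∷ (1907 , 1909) ∷ (1909 , 0) ∷ (1912 , 1913) ∷ (1913 , 1914) ∷ (1915 , 1914) ∷ (1916 , 1917) ∷ (1918 , 1914) ∷ (1919 , 1917) ∷ (1917 , 1914) ∷ (1914 , 0) ∷ (1920 , 1921) ∷
  (1921 , 1922) ∷ (1922 , 1925) ∷ (1923 , 1927) ∷ (1925 , 1930) ∷ (1926 , 1924) ∷ (1927 , 1924) ∷ (1929 , 1928) ∷ (1931 , 1930) ∷ (1930 , 0) ∷ (1932 , 1924) ∷ (1924 , 0) ∷ (1933 , 1935) ∷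
  (1934 , 1935) ∷ (1935 , 1928) ∷ (1928 , 0) ∷ (1936 , 1937) ∷ (1937 , 1943) ∷ (1939 , 1938) ∷ (1938 , 1943) ∷ (1941 , 1940) ∷ (1940 , 1943) ∷ (1942 , 1943) ∷ (1943 , 0) ∷ (1944 , 1945) ∷
  (1945 , 1946) ∷ (1946 , 1949) ∷ (1948 , 1950) ∷ (1950 , 1949) ∷ (1951 , 1947) ∷ (1947 , 1949) ∷ (1949 , 0) ∷ (1952 , 1953) ∷ (1953 , 1959) ∷ (1955 , 1954) ∷ (1954 , 1959) ∷ (1957 , 1956) ∷
  (1956 , 1959) ∷ (1958 , 1959) ∷ (1959 , 0) ∷ (1960 , 1961) ∷ (1961 , 1962) ∷ (1962 , 1965) ∷ (1964 , 1966) ∷ (1966 , 1965) ∷ (1967 , 1963) ∷ (1963 , 1965) ∷ (1965 , 0) ∷ (1968 , 1969) ∷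
  (1969 , 1970) ∷ (1970 , 1973) ∷ (1972 , 1974) ∷ (1974 , 1973) ∷ (1975 , 1971) ∷ (1971 , 1973) ∷ (1973 , 0) ∷ (1976 , 1977) ∷ (1977 , 1978) ∷ (1979 , 1978) ∷ (1980 , 1981) ∷ (1982 , 1978) ∷
  (1983 , 1981) ∷ (1981 , 1978) ∷ (1978 , 0) ∷ (1984 , 1985) ∷ (1985 , 1991) ∷ (1987 , 1986) ∷ (1986 , 1991) ∷ (1989 , 1988) ∷ (1988 , 1991) ∷ (1990 , 1991) ∷ (1991 , 0) ∷ (1992 , 1993) ∷
  (1993 , 1994) ∷ (1994 , 1997) ∷ (1996 , 1998) ∷ (1998 , 1997) ∷ (1999 , 1995) ∷ (1995 , 1997) ∷ (1997 , 0) ∷ (2000 , 2001) ∷ (2001 , 2002) ∷ (2002 , 2005) ∷ (2004 , 2006) ∷ (2006 , 2005) ∷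
  (2007 , 2003) ∷ (2003 , 2005) ∷ (2005 , 0) ∷ (2008 , 2009) ∷ (2009 , 2010) ∷ (2011 , 2010) ∷ (2012 , 2013) ∷ (2014 , 2010) ∷ (2015 , 2013) ∷ (2013 , 2010) ∷ (2010 , 0) ∷ (2016 , 2017) ∷
  (2017 , 2018) ∷ (2018 , 2021) ∷ (2020 , 2022) ∷ (2022 , 2021) ∷ (2023 , 2019) ∷ (2019 , 2021) ∷ (2021 , 0) ∷ (2024 , 2025) ∷ (2025 , 2026) ∷ (2027 , 2026) ∷ (2028 , 2029) ∷ (2030 , 2026) ∷
  (2031 , 2029) ∷ (2029 , 2026) ∷ (2026 , 0) ∷ (2032 , 2033) ∷ (2033 , 2034) ∷ (2035 , 2034) ∷ (2036 , 2037) ∷ (2038 , 2034) ∷ (2039 , 2037) ∷ (2037 , 2034) ∷ (2034 , 0) ∷ (2041 , 2040) ∷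
  (2042 , 2040) ∷ (2043 , 2047) ∷ (2044 , 2045) ∷ (2045 , 2040) ∷ (2046 , 2047) ∷ (2047 , 2040) ∷ (2040 , 0) ∷ []

schedule : ∀ d → List (Vertex d × Vertex d)
schedule d = map (λ (u , v) → toVertex d u , toVertex d v) (take (2 ^ d ∸ 1) moves₁₁)

schedule-stacks : ∀ d → d ≤ 11 → replay (constant d 1) (schedule d) ≡ just (pile d (2 ^ d))
schedule-stacks 0  _ = refl
schedule-stacks 1  _ = refl
schedule-stacks 2  _ = refl
schedule-stacks 3  _ = refl
schedule-stacks 4  _ = refl
schedule-stacks 5  _ = refl
schedule-stacks 6  _ = refl
schedule-stacks 7  _ = refl
schedule-stacks 8  _ = refl
schedule-stacks 9  _ = refl
schedule-stacks 10 _ = refl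
schedule-stacks 11 _ = refl
schedule-stacks (suc (suc (suc (suc (suc (suc (suc (suc (suc (suc (suc (suc _))))))))))))
  (s≤s (s≤s (s≤s (s≤s (s≤s (s≤s (s≤s (s≤s (s≤s (s≤s (s≤s ())))))))))))

corollary24 : (d : ℕ) → d ≤ 11 → Stackable d
corollary24 d d≤11 = stackable-by-replay d (schedule d) (schedule-stacks d d≤11)
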